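{- Let $\mathcal S=(\mathit{Sign},\mathit{Sen},\Omega,T)$ be a $\frac32$-institutional seed and $\mathcal T\subseteq\mathit{Sign}$ a (1-)subcategory such that: (i) a signature morphism is maximal iff it is $\mathit{Sen}$-maximal; (ii) $\mathcal T$ contains all maximal signature morphisms; (iii) $\varphi\in\mathcal T$ and $\varphi\le\varphi'$ imply $\varphi'\in\mathcal T$. In $\mathcal I(\mathcal S)$, let $(\theta_0,\theta_1,\theta_2)$ be a lax cocone with vertex $\Sigma$ for a span $(\varphi_1,\varphi_2)$ of signature morphisms and $\mu$ a signature morphism with $\operatorname{dom}\mu=\Sigma$. Then: 1. if $(\theta_0,\theta_1,\theta_2)$ is a lax $\mathcal T$-pushout and $\mu$ is model conservative, then the lax cocone $(\theta_0;\mu,\theta_1;\mu,\theta_2;\mu)$ has weak model amalgamation; 2. if there exists a lax $\mathcal T$-pushout $(\theta'_0,\theta'_1,\theta'_2)$ of the same span with $\theta_k;\mu\le\theta'_k$ for $k=0,1,2$ and $\mu$ is $\mathit{Sen}$-maximal, then $(\theta_0,\theta_1,\theta_2)$ has weak model amalgamation.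
   Context: Composition is diagrammatic. A $\frac32$-category: category with partially ordered hom-sets and monotone composition. $\mathbf{Pfn}$: sets and partial functions ordered by graph inclusion. A $\frac32$-institutional seed $(\mathit{Sign},\mathit{Sen},\Omega,T)$: a $\frac32$-category $\mathit{Sign}$, a lax $\frac32$-functor $\mathit{Sen}:\mathit{Sign}\to\mathbf{Pfn}$ (monotone; $\mathit{Sen}(\varphi);\mathit{Sen}(\varphi')\subseteq\mathit{Sen}(\varphi;\varphi')$; $1\subseteq\mathit{Sen}(1_\Sigma)$), an object $\Omega$, $T:\mathit{Sen}(\Omega)\to\{0,1\}$. In $\mathcal I(\mathcal S)$: $\Sigma$-models are arrows $M:\Sigma\to\Omega$ with $\mathit{Sen}(M)$ total; $\mathit{Mod}(\varphi)M'=\{M\text{ a }\operatorname{dom}\varphi\text{ -model}\mid\varphi;M'\le M\}$; $M\models\rho$ iff $T(\mathit{Sen}(M)\rho)=1$. $\varphi$ is maximal if no $\varphi'\ne\varphi$ has $\varphi\le\varphi'$; $\mathit{Sen}$-maximal if $\mathit{Sen}(\varphi)$ is total. For a span $\varphi_k:\Sigma_0\to\Sigma_k$ ($k=1,2$): a lax cocone is $\theta_k:\Sigma_k\to\Sigma$ ($k=0,1,2$) with $\varphi_k;\theta_k\le\theta_0$; a lax $\mathcal T$-pushout is a lax cocone with all $\theta_k\in\mathcal T$ such that for each such lax cocone $\theta'$ with components in $\mathcal T$ there is a unique $\mu\in\mathcal T$ with $\theta_k;\mu=\theta'_k$. A model of the span: $\Sigma_k$-models $M_k$ with $M_0\in\mathit{Mod}(\varphi_k)M_k$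 ($k=1,2$); weak model amalgamation of a lax cocone: every model of the span admits a vertex model $M$ with $M_k\in\mathit{Mod}(\theta_k)M$, $k=0,1,2$. $\mu$ is model conservative if every $\operatorname{dom}\mu$-model lies in $\mathit{Mod}(\mu)M'$ for some $\operatorname{cod}\mu$-model $M'$. -}

module Defs where

open import Level using (Level; _⊔_) renaming (suc to lsuc)
open import Data.Product using (Σ; ∃; ∃-syntax; _×_; _,_)
open import Data.Bool using (Bool)
open import Relation.Binary.PropositionalEquality using (_≡_; refl; trans; cong)

record ThreeHalfCat (o h r : Level) : Set (lsuc (o ⊔ h ⊔ r)) where
  infixr 9 _⨾_
  infix 4 _≤_
  field
    Obj  : Set o
    Hom  : Obj → Obj → Set h
    id   : ∀ {A} → Hom A A
    _⨾_  : ∀ {A B C} → Hom A B → Hom B C → Hom A C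
    idˡ  : ∀ {A B} (f : Hom A B) → id ⨾ f ≡ f
    idʳ  : ∀ {A B} (f : Hom A B) → f ⨾ id ≡ f
    assoc : ∀ {A B C D} (f : Hom A B) (g : Hom B C) (k : Hom C D) →
            (f ⨾ g) ⨾ k ≡ f ⨾ (g ⨾ k)
    _≤_  : ∀ {A B} → Hom A B → Hom A B → Set r
    ≤-refl    : ∀ {A B} {f : Hom A B} → f ≤ f
    ≤-trans   : ∀ {A B} {f g k : Hom A B} → f ≤ g → g ≤ k → f ≤ k
    ≤-antisym : ∀ {A B} {f g : Hom A B} → f ≤ g → g ≤ f → f ≡ g
    ⨾-mono    : ∀ {A B C} {f f' : Hom A B} {g g' : Hom B C} →
                f ≤ f' → g ≤ g' → f ⨾ g ≤ f' ⨾ g'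

-- Pfn: partial functions, represented by their (functional) graphs,
-- ordered by graph inclusion.

record PFun {s : Level} (A B : Set s) : Set (lsuc s) where
  field
    graph      : A → B → Set s
    functional : ∀ {x y y'} → graph x y → graph x y' → y ≡ y'
open PFun public

_⊆ₚ_ : ∀ {s} {A B : Set s} → PFun A B → PFun A B → Set s
f ⊆ₚ g = ∀ {x y} → graph f x y → graph g x y

Totalₚ : ∀ {s} {A B : Set s} → PFun A B → Set s
Totalₚ {A = A} f = ∀ (x : A) → ∃[ y ] graph f x y

idₚ : ∀ {s} {A : Set s} → PFun A A
idₚ = record { graph = λ x y → x ≡ y ; functional = λ p q → trans (sym' p) q }
  where
  sym' : ∀ {a} {X : Set a} {x y : X} → x ≡ y → y ≡ x
  sym' refl = refl

_⨾ₚ_ : ∀ {s} {A B C : Set s} → PFun A B → PFun B C → PFun A C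
f ⨾ₚ g = record
  { graph = λ x z → ∃[ y ] (graph f x y × graph g y z)
  ; functional = λ { (y , p , q) (y' , p' , q') → helper (functional f p p') q q' }
  }
  where
  helper : ∀ {y y' z z'} → y ≡ y' → graph g y z → graph g y' z' → z ≡ z'
  helper refl q q' = functional g q q'

record Seed (o h r s : Level) : Set (lsuc (o ⊔ h ⊔ r ⊔ s)) where
  field
    Sign : ThreeHalfCat o h r
  open ThreeHalfCat Sign public
  field
    -- lax 3/2-functor Sen : Sign → Pfn
    SenObj  : Obj → Set s
    Sen     : ∀ {A B} → Hom A B → PFun (SenObj A) (SenObj B)
    Sen-mono : ∀ {A B} {φ φ' : Hom A B} → φ ≤ φ' → Sen φ ⊆ₚ Sen φ'
    Sen-comp : ∀ {A B C} (φ : Hom A B) (φ' : Hom B C) →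
               (Sen φ ⨾ₚ Sen φ') ⊆ₚ Sen (φ ⨾ φ')
    Sen-id   : ∀ {A} → idₚ ⊆ₚ Sen (id {A})
    Ω : Obj
    T : SenObj Ω → Bool

record Subcat {o h r s} (S : Seed o h r s) (ℓ : Level) : Set (o ⊔ h ⊔ lsuc ℓ) where
  open Seed S
  field
    InObj  : Obj → Set ℓ
    In     : ∀ {A B} → Hom A B → Set ℓ
    In-dom : ∀ {A B} {f : Hom A B} → In f → InObj A
    In-cod : ∀ {A B} {f : Hom A B} → In f → InObj B
    In-id  : ∀ {A} → InObj A → In (id {A})
    In-comp : ∀ {A B C} {f : Hom A B} {g : Hom B C} → In f → In g → In (f ⨾ g)

module Notions {o h r s} (S : Seed o h r s) where
  open Seed S

  IsModel : ∀ {X} → Hom X Ω → Set s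
  IsModel M = Totalₚ (Sen M)

  InMod : ∀ {A B} (φ : Hom A B) (M : Hom A Ω) (M' : Hom B Ω) → Set (s ⊔ r)
  InMod φ M M' = IsModel M × (φ ⨾ M' ≤ M)

  Maximal : ∀ {A B} → Hom A B → Set (h ⊔ r)
  Maximal {A} {B} φ = ∀ (φ' : Hom A B) → φ ≤ φ' → φ' ≡ φ

  SenMaximal : ∀ {A B} → Hom A B → Set s
  SenMaximal φ = Totalₚ (Sen φ)

  LaxCocone : ∀ {S₀ S₁ S₂ V} (φ₁ : Hom S₀ S₁) (φ₂ : Hom S₀ S₂)
              (θ₀ : Hom S₀ V) (θ₁ : Hom S₁ V) (θ₂ : Hom S₂ V) → Set r
  LaxCocone φ₁ φ₂ θ₀ θ₁ θ₂ = (φ₁ ⨾ θ₁ ≤ θ₀) × (φ₂ ⨾ θ₂ ≤ θ₀)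

  LaxPushout : ∀ {ℓ} (𝒯 : Subcat S ℓ) {S₀ S₁ S₂ V} (φ₁ : Hom S₀ S₁) (φ₂ : Hom S₀ S₂)
               (θ₀ : Hom S₀ V) (θ₁ : Hom S₁ V) (θ₂ : Hom S₂ V) → Set (o ⊔ h ⊔ r ⊔ ℓ)
  LaxPushout 𝒯 {S₀} {S₁} {S₂} {V} φ₁ φ₂ θ₀ θ₁ θ₂ =
    LaxCocone φ₁ φ₂ θ₀ θ₁ θ₂ × In θ₀ × In θ₁ × In θ₂ ×
    (∀ {V'} (θ₀' : Hom S₀ V') (θ₁' : Hom S₁ V') (θ₂' : Hom S₂ V') →
       LaxCocone φ₁ φ₂ θ₀' θ₁' θ₂' → In θ₀' → In θ₁' → In θ₂' →
       Σ (Hom V V') λ μ →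
         (In μ × θ₀ ⨾ μ ≡ θ₀' × θ₁ ⨾ μ ≡ θ₁' × θ₂ ⨾ μ ≡ θ₂') ×
         (∀ (μ' : Hom V V') → In μ' → θ₀ ⨾ μ' ≡ θ₀' → θ₁ ⨾ μ' ≡ θ₁' →
            θ₂ ⨾ μ' ≡ θ₂' → μ' ≡ μ))
    where open Subcat 𝒯

  SpanModel : ∀ {S₀ S₁ S₂} (φ₁ : Hom S₀ S₁) (φ₂ : Hom S₀ S₂)
              (M₀ : Hom S₀ Ω) (M₁ : Hom S₁ Ω) (M₂ : Hom S₂ Ω) → Set (s ⊔ r)
  SpanModel φ₁ φ₂ M₀ M₁ M₂ =
    IsModel M₁ × IsModel M₂ × InMod φ₁ M₀ M₁ × InMod φ₂ M₀ M₂

  WeakAmalgamation : ∀ {S₀ S₁ S₂ V} (φ₁ : Hom S₀ S₁) (φ₂ : Hom S₀ S₂)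
              (θ₀ : Hom S₀ V) (θ₁ : Hom S₁ V) (θ₂ : Hom S₂ V) → Set (h ⊔ r ⊔ s)
  WeakAmalgamation {S₀} {S₁} {S₂} {V} φ₁ φ₂ θ₀ θ₁ θ₂ =
    ∀ (M₀ : Hom S₀ Ω) (M₁ : Hom S₁ Ω) (M₂ : Hom S₂ Ω) →
      SpanModel φ₁ φ₂ M₀ M₁ M₂ →
      Σ (Hom V Ω) λ M → IsModel M × InMod θ₀ M₀ M × InMod θ₁ M₁ M × InMod θ₂ M₂ M

  ModelConservative : ∀ {A B} → Hom A B → Set (h ⊔ r ⊔ s)
  ModelConservative {A} {B} μ =
    ∀ (M : Hom A Ω) → IsModel M → Σ (Hom B Ω) λ M' → IsModel M' × InMod μ M M'

module Submission where

-- The heart of the argument is that, under hypotheses (i)-(iii), a lax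
-- T-pushout has *exact* amalgamation: every model (M₀, M₁, M₂) of the span
-- is the reduct of a vertex model u with θₖ ⨾ u = Mₖ.  Models are Sen-maximal,
-- hence maximal (i), hence in T (ii), so (M₀, M₁, M₂) is a lax cocone in T
-- and the pushout yields a mediating u ∈ T.  Any u' ≥ u is in T (iii) and
-- still satisfies θₖ ⨾ u' = Mₖ because Mₖ is maximal; uniqueness of the
-- mediator gives u' = u, so u is maximal and hence a model (i).
--
-- Both parts then follow by monotonicity of composition: in part 1 the
-- conservative extension N of u satisfies (θₖ ⨾ μ) ⨾ N ≤ θₖ ⨾ u = Mₖ; in
-- part 2 the amalgam u of the larger pushout θ' gives the vertex model μ ⨾ u
-- (a model since μ and u are Sen-total) with θₖ ⨾ (μ ⨾ u) ≤ θ'ₖ ⨾ u = Mₖ.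

open import Defs
open import Level using (Level; _⊔_)
open import Data.Product using (Σ; _×_; _,_; proj₁; proj₂)
open import Relation.Binary.PropositionalEquality using (_≡_; refl; sym)

module ThreeHalfCatFacts {o h r} (C : ThreeHalfCat o h r) where
  open ThreeHalfCat C

  ≡⇒≤ : ∀ {A B} {f g : Hom A B} → f ≡ g → f ≤ g
  ≡⇒≤ refl = ≤-refl

  precompose-below : ∀ {X Y W Z} (θ : Hom X Y) (μ : Hom Y W) {u : Hom Y Z}
                     {N : Hom W Z} {M : Hom X Z} →
                     μ ⨾ N ≤ u → θ ⨾ u ≡ M → (θ ⨾ μ) ⨾ N ≤ M
  precompose-below θ μ {N = N} μN≤u θu≡M =
    ≤-trans (≡⇒≤ (assoc θ μ N)) (≤-trans (⨾-mono ≤-refl μN≤u) (≡⇒≤ θu≡M))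

  postcompose-below : ∀ {X Y W Z} (θ : Hom X Y) (μ : Hom Y W) {θ' : Hom X W}
                      (u : Hom W Z) {M : Hom X Z} →
                      θ ⨾ μ ≤ θ' → θ' ⨾ u ≡ M → θ ⨾ (μ ⨾ u) ≤ M
  postcompose-below θ μ u θμ≤θ' θ'u≡M =
    ≤-trans (≡⇒≤ (sym (assoc θ μ u))) (≤-trans (⨾-mono θμ≤θ' ≤-refl) (≡⇒≤ θ'u≡M))

  maximal-composite-stable : ∀ {X Y Z} (θ : Hom X Y) {u u' : Hom Y Z} {M : Hom X Z} →
                             (∀ M' → M ≤ M' → M' ≡ M) →
                             θ ⨾ u ≡ M → u ≤ u' → θ ⨾ u' ≡ M
  maximal-composite-stable θ {u' = u'} maxM θu≡M u≤u' =
    maxM (θ ⨾ u') (≤-trans (≡⇒≤ (sym θu≡M)) (⨾-mono ≤-refl u≤u'))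

module SeedFacts {o h r s} (S : Seed o h r s) where
  open Seed S
  open Notions S

  SenMaximal-⨾ : ∀ {X Y Z} (φ : Hom X Y) (ψ : Hom Y Z) →
                 SenMaximal φ → SenMaximal ψ → SenMaximal (φ ⨾ ψ)
  SenMaximal-⨾ φ ψ totφ totψ x =
    let (y , xφy) = totφ x
        (z , yψz) = totψ y
    in z , Sen-comp φ ψ (y , xφy , yψz)

  ExactAmalgam : ∀ {S₀ S₁ S₂ V} (θ₀ : Hom S₀ V) (θ₁ : Hom S₁ V) (θ₂ : Hom S₂ V)
                 (M₀ : Hom S₀ Ω) (M₁ : Hom S₁ Ω) (M₂ : Hom S₂ Ω) → Set (h ⊔ s)
  ExactAmalgam {V = V} θ₀ θ₁ θ₂ M₀ M₁ M₂ =
    Σ (Hom V Ω) λ u → IsModel u × θ₀ ⨾ u ≡ M₀ × θ₁ ⨾ u ≡ M₁ × θ₂ ⨾ u ≡ M₂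

  amalgamate : ∀ {S₀ S₁ S₂ V} {φ₁ : Hom S₀ S₁} {φ₂ : Hom S₀ S₂}
               {θ₀ : Hom S₀ V} {θ₁ : Hom S₁ V} {θ₂ : Hom S₂ V}
               {M₀ : Hom S₀ Ω} {M₁ : Hom S₁ Ω} {M₂ : Hom S₂ Ω} →
               SpanModel φ₁ φ₂ M₀ M₁ M₂ → (M : Hom V Ω) → IsModel M →
               θ₀ ⨾ M ≤ M₀ → θ₁ ⨾ M ≤ M₁ → θ₂ ⨾ M ≤ M₂ →
               Σ (Hom V Ω) λ M → IsModel M × InMod θ₀ M₀ M × InMod θ₁ M₁ M × InMod θ₂ M₂ M
  amalgamate (m₁ , m₂ , (m₀ , _) , _) M mM le₀ le₁ le₂ =
    M , mM , (m₀ , le₀) , (m₁ , le₁) , (m₂ , le₂)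

module Amalgamation {o h r s ℓ : Level} (S : Seed o h r s) (𝒯 : Subcat S ℓ) where
  open Seed S
  open Notions S
  open Subcat 𝒯
  open ThreeHalfCatFacts Sign
  open SeedFacts S

  module Hypotheses (maximal⇔SenMaximal : ∀ {A B} (φ : Hom A B) →
                                 (Maximal φ → SenMaximal φ) × (SenMaximal φ → Maximal φ))
           (maximal⇒In : ∀ {A B} (φ : Hom A B) → Maximal φ → In φ)
           (In-upward : ∀ {A B} (φ φ' : Hom A B) → In φ → φ ≤ φ' → In φ') where

    model⇒maximal : ∀ {X} (M : Hom X Ω) → IsModel M → Maximal M
    model⇒maximal M = proj₂ (maximal⇔SenMaximal M)

    model⇒In : ∀ {X} (M : Hom X Ω) → IsModel M → In M
    model⇒In M mM = maximal⇒In M (model⇒maximal M mM)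

    pushout-exact-amalgamation :
      ∀ {S₀ S₁ S₂ V} {φ₁ : Hom S₀ S₁} {φ₂ : Hom S₀ S₂}
        {θ₀ : Hom S₀ V} {θ₁ : Hom S₁ V} {θ₂ : Hom S₂ V} →
      LaxPushout 𝒯 φ₁ φ₂ θ₀ θ₁ θ₂ →
      ∀ {M₀ M₁ M₂} → SpanModel φ₁ φ₂ M₀ M₁ M₂ → ExactAmalgam θ₀ θ₁ θ₂ M₀ M₁ M₂
    pushout-exact-amalgamation {θ₀ = θ₀} {θ₁} {θ₂} (_ , _ , _ , _ , universal)
                               {M₀} {M₁} {M₂} (m₁ , m₂ , (m₀ , φ₁M₁≤M₀) , (_ , φ₂M₂≤M₀))
      with universal M₀ M₁ M₂ (φ₁M₁≤M₀ , φ₂M₂≤M₀) (model⇒In M₀ m₀) (model⇒In M₁ m₁) (model⇒In M₂ m₂)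
    ... | u , (u∈𝒯 , θ₀u≡M₀ , θ₁u≡M₁ , θ₂u≡M₂) , unique =
      u , proj₁ (maximal⇔SenMaximal u) u-maximal , θ₀u≡M₀ , θ₁u≡M₁ , θ₂u≡M₂
      where
      -- every u' ≥ u is again a mediator, hence equal to u
      u-maximal : Maximal u
      u-maximal u' u≤u' =
        unique u' (In-upward u u' u∈𝒯 u≤u')
          (maximal-composite-stable θ₀ (model⇒maximal M₀ m₀) θ₀u≡M₀ u≤u')
          (maximal-composite-stable θ₁ (model⇒maximal M₁ m₁) θ₁u≡M₁ u≤u')
          (maximal-composite-stable θ₂ (model⇒maximal M₂ m₂) θ₂u≡M₂ u≤u')

    pushout-then-conservative :
      ∀ {S₀ S₁ S₂ V V'} (φ₁ : Hom S₀ S₁) (φ₂ : Hom S₀ S₂)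
        (θ₀ : Hom S₀ V) (θ₁ : Hom S₁ V) (θ₂ : Hom S₂ V) (μ : Hom V V') →
      LaxPushout 𝒯 φ₁ φ₂ θ₀ θ₁ θ₂ → ModelConservative μ →
      WeakAmalgamation φ₁ φ₂ (θ₀ ⨾ μ) (θ₁ ⨾ μ) (θ₂ ⨾ μ)
    pushout-then-conservative φ₁ φ₂ θ₀ θ₁ θ₂ μ pushout conservative M₀ M₁ M₂ spanModel =
      let (u , mu , θ₀u≡M₀ , θ₁u≡M₁ , θ₂u≡M₂) = pushout-exact-amalgamation pushout spanModel
          (N , mN , _ , μN≤u) = conservative u mu
      in amalgamate spanModel N mN
           (precompose-below θ₀ μ μN≤u θ₀u≡M₀)
           (precompose-below θ₁ μ μN≤u θ₁u≡M₁)
           (precompose-below θ₂ μ μN≤u θ₂u≡M₂)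

    below-pushout-amalgamation :
      ∀ {S₀ S₁ S₂ V V'} (φ₁ : Hom S₀ S₁) (φ₂ : Hom S₀ S₂)
        (θ₀ : Hom S₀ V) (θ₁ : Hom S₁ V) (θ₂ : Hom S₂ V) (μ : Hom V V') →
      (Σ (Hom S₀ V') λ θ₀' → Σ (Hom S₁ V') λ θ₁' → Σ (Hom S₂ V') λ θ₂' →
         LaxPushout 𝒯 φ₁ φ₂ θ₀' θ₁' θ₂' ×
         θ₀ ⨾ μ ≤ θ₀' × θ₁ ⨾ μ ≤ θ₁' × θ₂ ⨾ μ ≤ θ₂') →
      SenMaximal μ → WeakAmalgamation φ₁ φ₂ θ₀ θ₁ θ₂
    below-pushout-amalgamation φ₁ φ₂ θ₀ θ₁ θ₂ μ
        (_ , _ , _ , pushout , θ₀μ≤θ₀' , θ₁μ≤θ₁' , θ₂μ≤θ₂') μ-total M₀ M₁ M₂ spanModel =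
      let (u , mu , θ₀'u≡M₀ , θ₁'u≡M₁ , θ₂'u≡M₂) = pushout-exact-amalgamation pushout spanModel
      in amalgamate spanModel (μ ⨾ u) (SenMaximal-⨾ μ u μ-total mu)
           (postcompose-below θ₀ μ u θ₀μ≤θ₀' θ₀'u≡M₀)
           (postcompose-below θ₁ μ u θ₁μ≤θ₁' θ₁'u≡M₁)
           (postcompose-below θ₂ μ u θ₂μ≤θ₂' θ₂'u≡M₂)

mainTheorem6 : ∀ {o h r s ℓ : Level} (S : Seed o h r s) (𝒯 : Subcat S ℓ) →
    let open Seed S
        open Notions S
        open Subcat 𝒯
    in
    -- (i) maximal iff Sen-maximal
    (∀ {A B} (φ : Hom A B) → (Maximal φ → SenMaximal φ) × (SenMaximal φ → Maximal φ)) →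
    -- (ii) 𝒯 contains all maximal signature morphisms
    (∀ {A B} (φ : Hom A B) → Maximal φ → In φ) →
    -- (iii) 𝒯 is upward closed
    (∀ {A B} (φ φ' : Hom A B) → In φ → φ ≤ φ' → In φ') →
    ∀ {S₀ S₁ S₂ V V'} (φ₁ : Hom S₀ S₁) (φ₂ : Hom S₀ S₂)
      (θ₀ : Hom S₀ V) (θ₁ : Hom S₁ V) (θ₂ : Hom S₂ V) (μ : Hom V V') →
    LaxCocone φ₁ φ₂ θ₀ θ₁ θ₂ →
    -- part 1
    (LaxPushout 𝒯 φ₁ φ₂ θ₀ θ₁ θ₂ → ModelConservative μ →
       WeakAmalgamation φ₁ φ₂ (θ₀ ⨾ μ) (θ₁ ⨾ μ) (θ₂ ⨾ μ))
    ×
    -- part 2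
    ((Σ (Hom S₀ V') λ θ₀' → Σ (Hom S₁ V') λ θ₁' → Σ (Hom S₂ V') λ θ₂' →
        LaxPushout 𝒯 φ₁ φ₂ θ₀' θ₁' θ₂' ×
        θ₀ ⨾ μ ≤ θ₀' × θ₁ ⨾ μ ≤ θ₁' × θ₂ ⨾ μ ≤ θ₂') →
     SenMaximal μ →
     WeakAmalgamation φ₁ φ₂ θ₀ θ₁ θ₂)
mainTheorem6 S 𝒯 hypⁱ hypⁱⁱ hypⁱⁱⁱ φ₁ φ₂ θ₀ θ₁ θ₂ μ _ =
  pushout-then-conservative φ₁ φ₂ θ₀ θ₁ θ₂ μ ,
  below-pushout-amalgamation φ₁ φ₂ θ₀ θ₁ θ₂ μ
  where open Amalgamation.Hypotheses S 𝒯 hypⁱ hypⁱⁱ hypⁱⁱⁱ
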